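{- Let $m\ge 3$ be odd and $k$ an integer with $1\le k\le m+1$. Then $G(2m+k,3m+k)$ has a $(2m+k,3m+k)$-admissible path partition $K_k$, and there are $(m-1)!$ pairwise Klein bottle nonequivalent $C_4$-face-magic Klein bottle labelings $X$ of $\mathcal{K}_{m,6}$ with $\mathcal{L}(X)=K_k$.
   Context: Here $n=6$. $\mathcal{K}_{m,6}$: vertex set $\{(i,j):1\le i\le m,1\le j\le 6\}$, edges $(i,j)(i,j+1)$ ($j\le 5$), $(i,6)(i,1)$, $(i,j)(i+1,j)$ ($i\le m-1$), $(m,j)(1,7-j)$. Its $4$-cycle faces (column indices mod $6$): $\{(i,j),(i,j+1),(i+1,j),(i+1,j+1)\}$, $1\le i\le m-1$, and $\{(m,j),(m,j+1),(1,7-j),(1,6-j)\}$. A $C_4$-face-magic Klein bottle labeling is a bijection $(i,j)\mapsto x_{i,j}$ onto $\{1,\dots,6m\}$ with all face sums equal. Equivalence: with $U(i,j)=(i+1,j)$ ($i<m$), $U(m,j)=(1,7-j)$, $H(i,j)=(i,j+3)$ (mod $6$), $F(i,j)=(i,7-j)$, $KBLS(m,6)=\langle U,H,F\rangle$; $X,X'$ are Klein bottle equivalent if $X'=\{x_{A(i,j)}\}$ for some $A\in KBLS(m,6)$. For integers $a_1,a_2$, $G(a_1,a_2)$ has vertex set $\{\{q,6m+1-q\}:1\le q\le 3m\}$; distinct vertices $\{x_1,x_2\},\{y_1,y_2\}$ are adjacent iff $z_1+z_2\in\{a_1,a_2\}$ for some $z_1\in\{x_1,x_2\}$, $z_2\in\{y_1,y_2\}$.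 A path on $3$ distinct vertices $V_1,V_2,V_3$ is $(a_1,a_2)$-admissible if there are $z_j\in V_j$ with $z_1+z_2=a_1$, $z_2+z_3=a_2$. An $(a_1,a_2)$-admissible path partition is a spanning subgraph of $G(a_1,a_2)$ that is a disjoint union of $m$ distinct admissible paths. For a $C_4$-face-magic labeling $X$, $\mathcal{L}(X)$ is the graph on the same vertex set with edges between $\{x_{2i-1,j},6m+1-x_{2i-1,j}\}$ and $\{x_{2i-1,j+1},6m+1-x_{2i-1,j+1}\}$ for $1\le i\le (m+1)/2$, $j=1,2$, and between $\{x_{2i,7-j},6m+1-x_{2i,7-j}\}$ and $\{x_{2i,6-j},6m+1-x_{2i,6-j}\}$ for $1\le i\le (m-1)/2$, $j=1,2$. -}

module Defs where

open import Data.Nat using (ℕ; zero; suc; _+_; _*_; _∸_; _≤_; _<_; _⊓_; _%_)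
open import Data.Fin using (Fin; zero; suc; toℕ; opposite)
open import Data.Maybe using (Maybe; just; nothing)
import Data.Maybe as Maybe
open import Data.Product using (Σ; ∃; ∃-syntax; _×_; _,_)
open import Data.Sum using (_⊎_)
open import Data.List using (List; []; _∷_; length; concatMap; map; upTo)
open import Data.List.Relation.Unary.All using (All)
open import Data.List.Relation.Unary.Any using (Any)
open import Data.List.Relation.Binary.Permutation.Propositional using (_↭_)
open import Relation.Binary.PropositionalEquality using (_≡_; _≢_)
open import Relation.Nullary using (¬_)

-- The Klein bottle grid K_{m,6}, 0-indexed: rows Fin m, columns Fin 6.
-- Paper row i (1..m) = Fin index i-1; paper column j (1..6) = index j-1.

Pos : ℕ → Set
Pos m = Fin m × Fin 6

nextRow : ∀ {n} → Fin n → Maybe (Fin n)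
nextRow {suc zero} zero = nothing
nextRow {suc (suc n)} zero = just (suc zero)
nextRow {suc (suc n)} (suc i) = Maybe.map suc (nextRow i)

firstRow : ∀ {n} → Fin n → Fin n
firstRow {suc n} _ = zero

colSuc : Fin 6 → Fin 6
colSuc zero = suc zero
colSuc (suc zero) = suc (suc zero)
colSuc (suc (suc zero)) = suc (suc (suc zero))
colSuc (suc (suc (suc zero))) = suc (suc (suc (suc zero)))
colSuc (suc (suc (suc (suc zero)))) = suc (suc (suc (suc (suc zero))))
colSuc (suc (suc (suc (suc (suc zero))))) = zero

-- paper column j ↦ 7-j, i.e. 0-indexed c ↦ 5-c
colFlip : Fin 6 → Fin 6
colFlip = opposite

c0 c1 c2 c3 c4 c5 : Fin 6
c0 = zero
c1 = colSuc c0
c2 = colSuc c1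
c3 = colSuc c2
c4 = colSuc c3
c5 = colSuc c4

Labeling : ℕ → Set
Labeling m = Fin m → Fin 6 → ℕ

IsBijLabel : (m : ℕ) → Labeling m → Set
IsBijLabel m x =
  (∀ i j → 1 ≤ x i j × x i j ≤ 6 * m)
  × (∀ i j i' j' → x i j ≡ x i' j' → (i ≡ i') × (j ≡ j'))
  × (∀ v → 1 ≤ v → v ≤ 6 * m → ∃[ i ] ∃[ j ] (x i j ≡ v))

-- The 4-cycle face whose "top-left" vertex is (i,j):
--   interior (i not last row): (i,j),(i,j+1),(i+1,j),(i+1,j+1)
--   boundary (i = m, last row): (m,j),(m,j+1),(1,7-j),(1,6-j)
faceSum : ∀ {m} → Labeling m → Fin m → Fin 6 → ℕ
faceSum x i j with nextRow i
... | just i' = x i j + x i (colSuc j) + x i' j + x i' (colSuc j)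
... | nothing = x i j + x i (colSuc j)
              + x (firstRow i) (colFlip j) + x (firstRow i) (colFlip (colSuc j))

IsC4FaceMagic : (m : ℕ) → Labeling m → Set
IsC4FaceMagic m x = IsBijLabel m x × ∃[ s ] (∀ i j → faceSum x i j ≡ s)

-- Klein bottle equivalence: KBLS(m,6) = ⟨U,H,F⟩.  Since the group is
-- finite, its elements are exactly the finite words in U, H, F.

data Gen : Set where
  gU gH gF : Gen

genAct : ∀ {m} → Gen → Pos m → Pos m
genAct gU (i , j) with nextRow i
... | just i' = i' , j
... | nothing = firstRow i , colFlip j
genAct gH (i , j) = i , colSuc (colSuc (colSuc j))
genAct gF (i , j) = i , colFlip j

wordAct : ∀ {m} → List Gen → Pos m → Pos m
wordAct [] p = p
wordAct (g ∷ w) p = genAct g (wordAct w p)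

atPos : ∀ {m} → Labeling m → Pos m → ℕ
atPos x (i , j) = x i j

KBEquiv : ∀ {m} → Labeling m → Labeling m → Set
KBEquiv {m} x x' =
  Σ (List Gen) λ w → (∀ i j → x' i j ≡ atPos x (wordAct {m} w (i , j)))

-- The graphs.  A vertex {q, 6m+1-q} (1 ≤ q ≤ 3m) is represented by q.

InV : ℕ → ℕ → Set
InV m q = 1 ≤ q × q ≤ 3 * m

MemV : ℕ → ℕ → ℕ → Set
MemV m z q = (z ≡ q) ⊎ (z ≡ 6 * m + 1 ∸ q)

vert : ℕ → ℕ → ℕ
vert m z = z ⊓ (6 * m + 1 ∸ z)

Graph : Set₁
Graph = ℕ → ℕ → Set

GAdj : ℕ → ℕ → ℕ → Graph
GAdj m a₁ a₂ u v =
  InV m u × InV m v × u ≢ v ×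
  ∃[ z₁ ] ∃[ z₂ ] (MemV m z₁ u × MemV m z₂ v × ((z₁ + z₂ ≡ a₁) ⊎ (z₁ + z₂ ≡ a₂)))

Triple : Set
Triple = ℕ × ℕ × ℕ

AdmPath : ℕ → ℕ → ℕ → Triple → Set
AdmPath m a₁ a₂ (V₁ , V₂ , V₃) =
  InV m V₁ × InV m V₂ × InV m V₃ × V₁ ≢ V₂ × V₂ ≢ V₃ × V₁ ≢ V₃ ×
  ∃[ z₁ ] ∃[ z₂ ] ∃[ z₃ ]
    (MemV m z₁ V₁ × MemV m z₂ V₂ × MemV m z₃ V₃ × z₁ + z₂ ≡ a₁ × z₂ + z₃ ≡ a₂)

PathEdge : ℕ → ℕ → Triple → Set
PathEdge u v (V₁ , V₂ , V₃) =
  (u ≡ V₁ × v ≡ V₂) ⊎ (u ≡ V₂ × v ≡ V₁) ⊎ (u ≡ V₂ × v ≡ V₃) ⊎ (u ≡ V₃ × v ≡ V₂)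

tripleVerts : Triple → List ℕ
tripleVerts (a , b , c) = a ∷ b ∷ c ∷ []

IsAdmPathPartition : ℕ → ℕ → ℕ → Graph → Set
IsAdmPathPartition m a₁ a₂ E =
  (∀ u v → E u v → GAdj m a₁ a₂ u v)
  × Σ (List Triple) λ ps →
      length ps ≡ m
      × All (AdmPath m a₁ a₂) ps
      × (concatMap tripleVerts ps ↭ map suc (upTo (3 * m)))
      × (∀ u v → (E u v → Any (PathEdge u v) ps) × (Any (PathEdge u v) ps → E u v))

SameGraph : Graph → Graph → Set
SameGraph E E' = ∀ u v → (E u v → E' u v) × (E' u v → E u v)

Link : ℕ → ℕ → ℕ → Graph
Link m a b u v = (u ≡ vert m a × v ≡ vert m b) ⊎ (u ≡ vert m b × v ≡ vert m a)

-- 𝓛(X).  Paper rows 2i-1 (odd, 1-indexed) = even 0-indexed rows: edges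
-- columns 1–2, 2–3.  Paper rows 2i (even) = odd 0-indexed rows: edges
-- columns 6–5, 5–4.
LGraph : (m : ℕ) → Labeling m → Graph
LGraph m x u v = ∃[ i ]
  ( (toℕ i % 2 ≡ 0 × (Link m (x i c0) (x i c1) u v ⊎ Link m (x i c1) (x i c2) u v))
  ⊎ (toℕ i % 2 ≡ 1 × (Link m (x i c5) (x i c4) u v ⊎ Link m (x i c4) (x i c3) u v)))

{-# OPTIONS --safe #-}
module Submission where

-- For m = K' + L and k = K' + 1 the paths of K_k are the triples `chain K' L e` (e < m):
-- each is an admissible path a - b - c with a + b = 2m + k and b + c = 3m + k, and their
-- entries together are exactly 1, …, 3m.  A labeling puts one path (a, b, c) on each row,
-- read as a b c c̄ b̄ ā on even rows and ā b̄ c̄ c b a on odd rows, where z̄ = 6m + 1 − z; then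
-- every face sums to 2(6m + 1).  Since m is odd the last row is even, and the Klein-bottle
-- face joining it to the flipped first row has the same shape as an interior one.
-- Distributing the paths over the rows by a permutation fixing row 0 gives (m − 1)!
-- labelings.  A Klein-bottle symmetry moves rows only by a rotation, and a rotation that
-- keeps the path of row 0 in place is trivial, so distinct permutations stay nonequivalent.

open import Defs
open import Data.Nat
  using (ℕ; zero; suc; _+_; _*_; _∸_; _≤_; _<_; _%_; _!; _⊓_; _<ᵇ_; _≤?_; _<?_; z≤n; s≤s; z<s; s<s; s≤s⁻¹; NonZero)
open import Data.Nat.Properties
  using ( +-comm; +-assoc; +-suc; +-identityʳ; suc-injective; +-monoʳ-≤; +-monoˡ-≤; m≤m+n
        ; ≤-trans; ≤-reflexive; <⇒≤; ≤-<-trans; <⇒≱; ≮⇒≥; ≰⇒>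
        ; m+[n∸m]≡n; m∸n+n≡m; m+n∸m≡n; m∸[m∸n]≡n; m+n≤o⇒m≤o∸n; m≤n+o⇒m∸n≤o; m<n⇒0<n∸m; ∸-monoˡ-<
        ; m≤n⇒m⊓n≡m; m≥n⇒m⊓n≡n )
open import Data.Nat.DivMod using (%-distribˡ-+; m%n%n≡m%n; n%n≡0; m<n⇒m%n≡m; %-remove-+ʳ)
open import Data.Nat.Divisibility using (m%n≡0⇒n∣m)
open import Data.Nat.Tactic.RingSolver using (solve; solve-∀)
open import Data.Bool using (Bool; true; false; if_then_else_)
open import Data.Empty using (⊥-elim)
open import Data.Fin using (Fin; zero; suc; toℕ; fromℕ<; inject≤; remQuot; combine)
import Data.Fin.Properties as Fin
open import Data.Fin.Permutation
  using (Permutation; _⟨$⟩ʳ_; _⟨$⟩ˡ_; _≈_; inverseˡ; inverseʳ; lift₀; transpose; _∘ₚ_)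
  renaming (id to idₚ)
open import Data.Maybe using (just; nothing)
open import Data.Product using (Σ; ∃; ∃-syntax; _×_; _,_; proj₁; proj₂; uncurry)
open import Data.Product.Properties using (,-injective)
open import Data.Sum using (_⊎_; inj₁; inj₂; assocʳ; assocˡ)
import Data.Sum as Sum
open import Data.List
  using (List; []; _∷_; _++_; [_]; _∷ʳ_; map; upTo; applyUpTo; concatMap; cartesianProduct; allFin)
open import Data.List.Properties using (map-++; map-upTo; map-applyUpTo; applyUpTo-∷ʳ; length-map; length-upTo)
open import Data.List.Membership.Propositional using (_∈_; find; lose)
open import Data.List.Membership.Propositional.Properties
  using (∈-map⁺; ∈-map⁻; ∈-upTo⁺; ∈-upTo⁻; ∈-allFin; ∈-cartesianProduct⁺; ∈-cartesianProduct⁻)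
open import Data.List.Relation.Unary.Any using (Any; here; there)
import Data.List.Relation.Unary.All as All
import Data.List.Relation.Unary.All.Properties as Allₚ
open import Data.List.Relation.Unary.AllPairs using (_∷_)
open import Data.List.Relation.Unary.Unique.Propositional using (Unique)
import Data.List.Relation.Unary.Unique.Propositional.Properties as Unique
open import Data.List.Relation.Binary.Permutation.Propositional
  using (_↭_; ↭-refl; ↭-sym; prep; ↭⇒↭ₛ; module PermutationReasoning)
open import Data.List.Relation.Binary.Permutation.Propositional.Properties
  using (∷↭∷ʳ; ++⁺ˡ; ++⁺ʳ; ++⁺; ∈-resp-↭; ++-commutativeMonoid)
import Data.List.Relation.Binary.Permutation.Setoid.Properties as PermutationSetoid
open import Algebra.Solver.CommutativeMonoid (++-commutativeMonoid {A = ℕ})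
  using (_⊜_; _⊕_) renaming (solve to solve-↭)
open import Function using (_∘_; id)
open import Relation.Binary.PropositionalEquality hiding ([_])
open import Relation.Binary.PropositionalEquality.Properties using (setoid)
open import Relation.Nullary using (¬_; does; yes; no)
open import Relation.Nullary.Decidable using (dec-true; dec-false)

-- t = combine p s encodes the image p of 0 and the index s of a permutation of the rest.
permutation : ∀ n → Fin (n !) → Permutation n n
permutation zero    _ = idₚ
permutation (suc n) t =
  lift₀ (permutation n (proj₂ (remQuot {suc n} (n !) t))) ∘ₚ transpose zero (proj₁ (remQuot {suc n} (n !) t))

permutation-injective : ∀ n {t t'} → permutation n t ≈ permutation n t' → t ≡ t'
permutation-injective zero    {zero} {zero} _ = refl
permutation-injective (suc n) {t} {t'} π≈π' = begin
    t             ≡⟨ Fin.combine-remQuot {suc n} (n !) t ⟨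
    combine p s   ≡⟨ cong₂ combine p≡p' s≡s' ⟩
    combine p' s' ≡⟨ Fin.combine-remQuot {suc n} (n !) t' ⟩
    t'            ∎
  where
  open ≡-Reasoning
  p p' : Fin (suc n)
  s s' : Fin (n !)
  p  = proj₁ (remQuot {suc n} (n !) t)
  s  = proj₂ (remQuot {suc n} (n !) t)
  p' = proj₁ (remQuot {suc n} (n !) t')
  s' = proj₂ (remQuot {suc n} (n !) t')
  p≡p' : p ≡ p'
  p≡p' = π≈π' zero
  s≡s' : s ≡ s'
  s≡s' = permutation-injective n λ i → Fin.suc-injective (begin
    suc (permutation n s ⟨$⟩ʳ i)                                ≡⟨ inverseˡ (transpose zero p) ⟨
    transpose zero p ⟨$⟩ˡ (permutation (suc n) t ⟨$⟩ʳ suc i)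
      ≡⟨ cong₂ (λ q x → transpose zero q ⟨$⟩ˡ x) p≡p' (π≈π' (suc i)) ⟩
    transpose zero p' ⟨$⟩ˡ (permutation (suc n) t' ⟨$⟩ʳ suc i) ≡⟨ inverseˡ (transpose zero p') ⟩
    suc (permutation n s' ⟨$⟩ʳ i)                               ∎)

⟨$⟩ʳ-injective : ∀ {n} (π : Permutation n n) {i j} → π ⟨$⟩ʳ i ≡ π ⟨$⟩ʳ j → i ≡ j
⟨$⟩ʳ-injective π {i} {j} eq = trans (sym (inverseˡ π)) (trans (cong (π ⟨$⟩ˡ_) eq) (inverseˡ π))

toℕ-nextRow : ∀ {n} {i i' : Fin n} → nextRow i ≡ just i' → toℕ i' ≡ suc (toℕ i)
toℕ-nextRow {suc (suc n)} {zero}  refl = refl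
toℕ-nextRow {suc (suc n)} {suc i} eq with nextRow i in next
toℕ-nextRow {suc (suc n)} {suc i} refl | just _ = cong suc (toℕ-nextRow next)

nextRow-last : ∀ {n} {i : Fin n} → nextRow i ≡ nothing → suc (toℕ i) ≡ n
nextRow-last {suc zero}    {zero}  _ = refl
nextRow-last {suc (suc n)} {suc i} _ with nextRow i in next
... | nothing = cong suc (nextRow-last next)

suc-%-% : ∀ a n .{{_ : NonZero n}} → suc (a % n) % n ≡ suc a % n
suc-%-% a n = begin
  (1 + a % n) % n           ≡⟨ %-distribˡ-+ 1 (a % n) n ⟩
  (1 % n + a % n % n) % n   ≡⟨ cong (λ z → (1 % n + z) % n) (m%n%n≡m%n a n) ⟩
  (1 % n + a % n) % n       ≡⟨ %-distribˡ-+ 1 a n ⟨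
  (1 + a) % n               ∎
  where open ≡-Reasoning

genAct-U-row : ∀ {m'} (p : Pos (suc m')) → toℕ (proj₁ (genAct gU p)) ≡ suc (toℕ (proj₁ p)) % suc m'
genAct-U-row {m'} (i , _) with nextRow i in next
... | just i' = trans (toℕ-nextRow next)
                  (sym (m<n⇒m%n≡m (subst (_< suc m') (toℕ-nextRow next) (Fin.toℕ<n i'))))
... | nothing = sym (trans (cong (_% suc m') (nextRow-last next)) (n%n≡0 (suc m')))

wordAct-row : ∀ {m'} (w : List Gen) →
  ∃[ r ] ∀ p → toℕ (proj₁ (wordAct {suc m'} w p)) ≡ (toℕ (proj₁ p) + r) % suc m'
wordAct-row {m'} [] = 0 , λ (i , _) →
  sym (trans (cong (_% suc m') (+-identityʳ (toℕ i))) (m<n⇒m%n≡m (Fin.toℕ<n i)))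
wordAct-row {m'} (gU ∷ w) with r , rotation ← wordAct-row {m'} w = suc r , λ p → begin
  toℕ (proj₁ (genAct gU (wordAct w p)))     ≡⟨ genAct-U-row (wordAct w p) ⟩
  suc (toℕ (proj₁ (wordAct w p))) % suc m'  ≡⟨ cong (λ z → suc z % suc m') (rotation p) ⟩
  suc ((toℕ (proj₁ p) + r) % suc m') % suc m' ≡⟨ suc-%-% (toℕ (proj₁ p) + r) (suc m') ⟩
  suc (toℕ (proj₁ p) + r) % suc m'          ≡⟨ cong (_% suc m') (+-suc (toℕ (proj₁ p)) r) ⟨
  (toℕ (proj₁ p) + suc r) % suc m'          ∎
  where open ≡-Reasoning
wordAct-row (gH ∷ w) = wordAct-row w
wordAct-row (gF ∷ w) = wordAct-row w

wordAct-preserves-rows : ∀ {m'} (w : List Gen) {j₀} → proj₁ (wordAct {suc m'} w (zero , j₀)) ≡ zero →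
  ∀ p → proj₁ (wordAct w p) ≡ proj₁ p
wordAct-preserves-rows {m'} w {j₀} fixes-row₀ p@(i , _) with r , rotation ← wordAct-row {m'} w =
  Fin.toℕ-injective (begin
    toℕ (proj₁ (wordAct w p)) ≡⟨ rotation p ⟩
    (toℕ i + r) % suc m'      ≡⟨ %-remove-+ʳ (toℕ i) (m%n≡0⇒n∣m r (suc m') r%m≡0) ⟩
    toℕ i % suc m'            ≡⟨ m<n⇒m%n≡m (Fin.toℕ<n i) ⟩
    toℕ i                     ∎)
  where
  open ≡-Reasoning
  r%m≡0 : r % suc m' ≡ 0
  r%m≡0 = trans (sym (rotation (zero , j₀))) (cong toℕ fixes-row₀)

first second third : Triple → ℕ
first  = proj₁
second = proj₁ ∘ proj₂
third  = proj₂ ∘ proj₂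

component : Triple → Fin 3 → ℕ
component T zero             = first T
component T (suc zero)       = second T
component T (suc (suc zero)) = third T

InRange : ℕ → Triple → Set
InRange m T = ∀ r → InV m (component T r)

record IsChain (m a₁ a₂ : ℕ) (T : Triple) : Set where
  field
    first+second : first T + second T ≡ a₁
    second+third : second T + third T ≡ a₂
    inRange      : InRange m T

m+n≡o⇒m≤o : ∀ {m o} n → m + n ≡ o → m ≤ o
m+n≡o⇒m≤o {m} n eq = subst (m ≤_) eq (m≤m+n m n)

-- With m = K' + L, chain₁ (d < K') has entries in [1, K'], [2m + 1, 2m + K'], [m + 1, m + K']
-- and chain₂ (e < L) in [m + K' + 1, 2m], [K' + 1, m], [2m + K' + 1, 3m].
chain₁ : (K' L d : ℕ) → Triple
chain₁ K' L d = (suc d , suc (2 * (K' + L) + (K' ∸ suc d)) , suc (K' + L + d))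

chain₂ : (K' L e : ℕ) → Triple
chain₂ K' L e = (suc (K' + L + K' + e) , suc K' + (L ∸ suc e) , suc (2 * (K' + L) + K' + e))

chain : (K' L e : ℕ) → Triple
chain K' L e with e <? K'
... | yes _ = chain₁ K' L e
... | no  _ = chain₂ K' L (e ∸ K')

ChainOf : (K' L : ℕ) → Triple → Set
ChainOf K' L = IsChain (K' + L) (2 * (K' + L) + suc K') (3 * (K' + L) + suc K')

-- d' abstracts K' ∸ suc d, which no longer reduces once K' is matched as suc d + d'.
chain₁-isChain : ∀ K' L d d' → suc d + d' ≡ K' →
  ChainOf K' L (suc d , suc (2 * (K' + L) + d') , suc (K' + L + d))
chain₁-isChain .(suc d + d') L d d' refl = record
  { first+second = sum₁₂
  ; second+third = sum₂₃
  ; inRange      = λ where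
      zero             → s≤s z≤n , bound₁
      (suc zero)       → s≤s z≤n , bound₂
      (suc (suc zero)) → s≤s z≤n , bound₃
  }
  where
  sum₁₂ : suc d + suc (2 * (suc d + d' + L) + d') ≡ 2 * (suc d + d' + L) + suc (suc d + d')
  sum₁₂ = solve (L ∷ d ∷ d' ∷ [])
  sum₂₃ : suc (2 * (suc d + d' + L) + d') + suc (suc d + d' + L + d) ≡ 3 * (suc d + d' + L) + suc (suc d + d')
  sum₂₃ = solve (L ∷ d ∷ d' ∷ [])
  bound₁ : suc d ≤ 3 * (suc d + d' + L)
  bound₁ = m+n≡o⇒m≤o (2 * d + 3 * d' + 3 * L + 2) (solve (L ∷ d ∷ d' ∷ []))
  bound₂ : suc (2 * (suc d + d' + L) + d') ≤ 3 * (suc d + d' + L)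
  bound₂ = m+n≡o⇒m≤o (d + L) (solve (L ∷ d ∷ d' ∷ []))
  bound₃ : suc (suc d + d' + L + d) ≤ 3 * (suc d + d' + L)
  bound₃ = m+n≡o⇒m≤o (d + 2 * d' + 2 * L + 1) (solve (L ∷ d ∷ d' ∷ []))

chain₂-isChain : ∀ K' L e d → suc e + d ≡ L →
  ChainOf K' L (suc (K' + L + K' + e) , suc K' + d , suc (2 * (K' + L) + K' + e))
chain₂-isChain K' .(suc e + d) e d refl = record
  { first+second = sum₁₂
  ; second+third = sum₂₃
  ; inRange      = λ where
      zero             → s≤s z≤n , bound₁
      (suc zero)       → s≤s z≤n , bound₂
      (suc (suc zero)) → s≤s z≤n , bound₃
  }
  where
  sum₁₂ : suc (K' + (suc e + d) + K' + e) + (suc K' + d) ≡ 2 * (K' + (suc e + d)) + suc K'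
  sum₁₂ = solve (K' ∷ e ∷ d ∷ [])
  sum₂₃ : suc K' + d + suc (2 * (K' + (suc e + d)) + K' + e) ≡ 3 * (K' + (suc e + d)) + suc K'
  sum₂₃ = solve (K' ∷ e ∷ d ∷ [])
  bound₁ : suc (K' + (suc e + d) + K' + e) ≤ 3 * (K' + (suc e + d))
  bound₁ = m+n≡o⇒m≤o (K' + e + 2 * d + 1) (solve (K' ∷ e ∷ d ∷ []))
  bound₂ : suc K' + d ≤ 3 * (K' + (suc e + d))
  bound₂ = m+n≡o⇒m≤o (2 * K' + 3 * e + 2 * d + 2) (solve (K' ∷ e ∷ d ∷ []))
  bound₃ : suc (2 * (K' + (suc e + d)) + K' + e) ≤ 3 * (K' + (suc e + d))
  bound₃ = m+n≡o⇒m≤o d (solve (K' ∷ e ∷ d ∷ []))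

chain-isChain : ∀ K' L {e} → e < K' + L → ChainOf K' L (chain K' L e)
chain-isChain K' L {e} e<m with e <? K'
... | yes e<K' = chain₁-isChain K' L e (K' ∸ suc e) (m+[n∸m]≡n e<K')
... | no  e≮K' = chain₂-isChain K' L (e ∸ K') (L ∸ suc (e ∸ K')) (m+[n∸m]≡n e∸K'<L)
  where
  e∸K'<L : e ∸ K' < L
  e∸K'<L = subst (e ∸ K' <_) (m+n∸m≡n K' L) (∸-monoˡ-< e<m (≮⇒≥ e≮K'))

applyUpTo-++ : ∀ {A : Set} (f : ℕ → A) x y →
  applyUpTo f (x + y) ≡ applyUpTo f x ++ applyUpTo (λ i → f (x + i)) y
applyUpTo-++ f zero    y = refl
applyUpTo-++ f (suc x) y = cong (f 0 ∷_) (applyUpTo-++ (f ∘ suc) x y)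

applyUpTo-cong : ∀ {A : Set} {f g : ℕ → A} n → (∀ {i} → i < n → f i ≡ g i) →
  applyUpTo f n ≡ applyUpTo g n
applyUpTo-cong zero    _   = refl
applyUpTo-cong (suc n) f≡g = cong₂ _∷_ (f≡g z<s) (applyUpTo-cong n (f≡g ∘ s<s))

applyUpTo-reverse-↭ : ∀ {A : Set} (f : ℕ → A) n → applyUpTo (λ i → f (n ∸ suc i)) n ↭ applyUpTo f n
applyUpTo-reverse-↭ f zero    = ↭-refl
applyUpTo-reverse-↭ f (suc n) = begin
  f n ∷ applyUpTo (λ i → f (n ∸ suc i)) n ↭⟨ prep (f n) (applyUpTo-reverse-↭ f n) ⟩
  f n ∷ applyUpTo f n                     ↭⟨ ∷↭∷ʳ (f n) (applyUpTo f n) ⟩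
  applyUpTo f n ∷ʳ f n                    ≡⟨ applyUpTo-∷ʳ f n ⟩
  applyUpTo f (suc n)                     ∎
  where open PermutationReasoning

interval : ℕ → ℕ → List ℕ
interval a = applyUpTo (a +_)

interval-++ : ∀ {a b} x y → a + x ≡ b → interval a (x + y) ≡ interval a x ++ interval b y
interval-++ {a} x y a+x≡b = trans (applyUpTo-++ (a +_) x y)
  (cong (interval a x ++_) (applyUpTo-cong y λ {i} _ → trans (sym (+-assoc a x i)) (cong (_+ i) a+x≡b)))

interval-thirds : ∀ a n → interval a (3 * n) ≡ interval a n ++ interval (a + n) n ++ interval (a + 2 * n) n
interval-thirds a n = begin
  interval a (n + (n + (n + 0)))                                   ≡⟨ interval-++ n _ refl ⟩
  interval a n ++ interval (a + n) (n + (n + 0))                   ≡⟨ cong (interval a n ++_) (interval-++ n _ a+n+n) ⟩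
  interval a n ++ interval (a + n) n ++ interval (a + 2 * n) (n + 0)
    ≡⟨ cong (λ k → interval a n ++ interval (a + n) n ++ interval (a + 2 * n) k) (+-identityʳ n) ⟩
  interval a n ++ interval (a + n) n ++ interval (a + 2 * n) n     ∎
  where
  open ≡-Reasoning
  a+n+n : a + n + n ≡ a + 2 * n
  a+n+n = solve (a ∷ n ∷ [])

concatMap-tripleVerts-↭ : ∀ ts → concatMap tripleVerts ts ↭ map first ts ++ map second ts ++ map third ts
concatMap-tripleVerts-↭ []                = ↭-refl
concatMap-tripleVerts-↭ ((a , b , c) ∷ ts) = begin
  a ∷ b ∷ c ∷ concatMap tripleVerts ts                 ↭⟨ ++⁺ˡ (a ∷ b ∷ c ∷ []) (concatMap-tripleVerts-↭ ts) ⟩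
  [ a ] ++ [ b ] ++ [ c ] ++ (map first ts ++ map second ts ++ map third ts)
    ↭⟨ solve-↭ 6 (λ a b c A B C → a ⊕ b ⊕ c ⊕ (A ⊕ B ⊕ C) ⊜ (a ⊕ A) ⊕ (b ⊕ B) ⊕ (c ⊕ C)) ↭-refl
         [ a ] [ b ] [ c ] (map first ts) (map second ts) (map third ts) ⟩
  (a ∷ map first ts) ++ (b ∷ map second ts) ++ (c ∷ map third ts) ∎
  where open PermutationReasoning

chain-split : ∀ K' L → map (chain K' L) (upTo (K' + L)) ≡ applyUpTo (chain₁ K' L) K' ++ applyUpTo (chain₂ K' L) L
chain-split K' L = begin
  map (chain K' L) (upTo (K' + L))                                          ≡⟨ map-upTo (chain K' L) (K' + L) ⟩
  applyUpTo (chain K' L) (K' + L)                                           ≡⟨ applyUpTo-++ (chain K' L) K' L ⟩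
  applyUpTo (chain K' L) K' ++ applyUpTo (λ e → chain K' L (K' + e)) L
    ≡⟨ cong₂ _++_ (applyUpTo-cong K' chain-low) (applyUpTo-cong L λ _ → chain-high _) ⟩
  applyUpTo (chain₁ K' L) K' ++ applyUpTo (chain₂ K' L) L                 ∎
  where
  open ≡-Reasoning
  chain-low : ∀ {d} → d < K' → chain K' L d ≡ chain₁ K' L d
  chain-low {d} d<K' with d <? K'
  ... | yes _    = refl
  ... | no  d≮K' = ⊥-elim (d≮K' d<K')
  chain-high : ∀ e → chain K' L (K' + e) ≡ chain₂ K' L e
  chain-high e with K' + e <? K'
  ... | yes K'+e<K' = ⊥-elim (<⇒≱ K'+e<K' (m≤m+n K' e))
  ... | no  _       = cong (chain₂ K' L) (m+n∸m≡n K' e)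

map-applyUpTo-++ : ∀ {A B : Set} (g : A → B) (f h : ℕ → A) x y →
  map g (applyUpTo f x ++ applyUpTo h y) ≡ applyUpTo (g ∘ f) x ++ applyUpTo (g ∘ h) y
map-applyUpTo-++ g f h x y = trans (map-++ g (applyUpTo f x) (applyUpTo h y))
  (cong₂ _++_ (map-applyUpTo f g x) (map-applyUpTo h g y))

chain-cover : ∀ K' L → concatMap tripleVerts (map (chain K' L) (upTo (K' + L))) ↭ map suc (upTo (3 * (K' + L)))
chain-cover K' L = begin
  concatMap tripleVerts (map (chain K' L) (upTo m))      ≡⟨ cong (concatMap tripleVerts) (chain-split K' L) ⟩
  concatMap tripleVerts (ts₁ ++ ts₂)                     ↭⟨ concatMap-tripleVerts-↭ (ts₁ ++ ts₂) ⟩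
  map first (ts₁ ++ ts₂) ++ map second (ts₁ ++ ts₂) ++ map third (ts₁ ++ ts₂)
    ≡⟨ cong₂ _++_ (map-applyUpTo-++ first _ _ K' L)
         (cong₂ _++_ (map-applyUpTo-++ second _ _ K' L) (map-applyUpTo-++ third _ _ K' L)) ⟩
  (I₁ ++ I₄) ++ (applyUpTo (λ d → suc (2 * m) + (K' ∸ suc d)) K' ++ applyUpTo (λ e → suc K' + (L ∸ suc e)) L)
             ++ (I₃ ++ I₆)
    ↭⟨ ++⁺ˡ (I₁ ++ I₄) (++⁺ʳ (I₃ ++ I₆)
         (++⁺ (applyUpTo-reverse-↭ (suc (2 * m) +_) K') (applyUpTo-reverse-↭ (suc K' +_) L))) ⟩
  (I₁ ++ I₄) ++ (I₅ ++ I₂) ++ (I₃ ++ I₆)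
    ↭⟨ solve-↭ 6 (λ a b c d e f → (a ⊕ d) ⊕ (e ⊕ b) ⊕ (c ⊕ f) ⊜ (a ⊕ b) ⊕ (c ⊕ d) ⊕ (e ⊕ f)) ↭-refl
         I₁ I₂ I₃ I₄ I₅ I₆ ⟩
  (I₁ ++ I₂) ++ (I₃ ++ I₄) ++ (I₅ ++ I₆)
    ≡⟨ cong₂ _++_ (interval-++ K' L refl) (cong₂ _++_ (interval-++ K' L refl) (interval-++ K' L refl)) ⟨
  interval 1 m ++ interval (suc m) m ++ interval (suc (2 * m)) m ≡⟨ interval-thirds 1 m ⟨
  interval 1 (3 * m)                                     ≡⟨ map-upTo suc (3 * m) ⟨
  map suc (upTo (3 * m))                                 ∎
  where
  open PermutationReasoning
  m : ℕ
  m = K' + L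
  ts₁ ts₂ : List Triple
  ts₁ = applyUpTo (chain₁ K' L) K'
  ts₂ = applyUpTo (chain₂ K' L) L
  I₁ I₂ I₃ I₄ I₅ I₆ : List ℕ
  I₁ = interval 1 K'
  I₂ = interval (suc K') L
  I₃ = interval (suc m) K'
  I₄ = interval (suc m + K') L
  I₅ = interval (suc (2 * m)) K'
  I₆ = interval (suc (2 * m) + K') L

map-injectiveOn : ∀ {A B : Set} (f : A → B) {xs x y} → Unique (map f xs) → x ∈ xs → y ∈ xs → f x ≡ f y → x ≡ y
map-injectiveOn f _           (here refl)  (here refl)  _     = refl
map-injectiveOn f (fx∉ ∷ _)   (here refl)  (there y∈xs) fx≡fy = ⊥-elim (All.lookup fx∉ (∈-map⁺ f y∈xs) fx≡fy)
map-injectiveOn f (fy∉ ∷ _)   (there x∈xs) (here refl)  fx≡fy = ⊥-elim (All.lookup fy∉ (∈-map⁺ f x∈xs) (sym fx≡fy))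
map-injectiveOn f (_ ∷ uniq)  (there x∈xs) (there y∈xs) fx≡fy = map-injectiveOn f uniq x∈xs y∈xs fx≡fy

Unique-resp-↭ : ∀ {xs ys : List ℕ} → xs ↭ ys → Unique xs → Unique ys
Unique-resp-↭ xs↭ys = PermutationSetoid.Unique-resp-↭ (setoid ℕ) (↭⇒↭ₛ xs↭ys)

concatMap-tripleVerts : ∀ (f : ℕ → Triple) xs →
  concatMap tripleVerts (map f xs) ≡ map (uncurry (component ∘ f)) (cartesianProduct xs (allFin 3))
concatMap-tripleVerts f []       = refl
concatMap-tripleVerts f (x ∷ xs) = trans (cong (tripleVerts (f x) ++_) (concatMap-tripleVerts f xs))
  (sym (map-++ (uncurry (component ∘ f)) (map (x ,_) (allFin 3)) (cartesianProduct xs (allFin 3))))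

ComponentsDistinct : Triple → Set
ComponentsDistinct T = ∀ {r r'} → component T r ≡ component T r' → r ≡ r'

isChain⇒admPath : ∀ {m a₁ a₂ T} → IsChain m a₁ a₂ T → ComponentsDistinct T → AdmPath m a₁ a₂ T
isChain⇒admPath {T = T} c distinct =
  inRange zero , inRange (suc zero) , inRange (suc (suc zero)) ,
  Fin.0≢1+n ∘ distinct {zero} {suc zero} ,
  Fin.0≢1+n ∘ Fin.suc-injective ∘ distinct {suc zero} {suc (suc zero)} ,
  Fin.0≢1+n ∘ distinct {zero} {suc (suc zero)} ,
  first T , second T , third T , inj₁ refl , inj₁ refl , inj₁ refl , first+second , second+third
  where open IsChain c

admPath-edge⇒GAdj : ∀ {m a₁ a₂ T u v} → AdmPath m a₁ a₂ T → PathEdge u v T → GAdj m a₁ a₂ u v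
admPath-edge⇒GAdj (V₁ , V₂ , V₃ , V₁≢V₂ , V₂≢V₃ , _ , z₁ , z₂ , z₃ , z₁∈ , z₂∈ , z₃∈ , z₁+z₂ , z₂+z₃) =
  λ where
  (inj₁ (refl , refl))               → V₁ , V₂ , V₁≢V₂ , z₁ , z₂ , z₁∈ , z₂∈ , inj₁ z₁+z₂
  (inj₂ (inj₁ (refl , refl)))        →
    V₂ , V₁ , V₁≢V₂ ∘ sym , z₂ , z₁ , z₂∈ , z₁∈ , inj₁ (trans (+-comm z₂ z₁) z₁+z₂)
  (inj₂ (inj₂ (inj₁ (refl , refl)))) → V₂ , V₃ , V₂≢V₃ , z₂ , z₃ , z₂∈ , z₃∈ , inj₂ z₂+z₃
  (inj₂ (inj₂ (inj₂ (refl , refl)))) →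
    V₃ , V₂ , V₂≢V₃ ∘ sym , z₃ , z₂ , z₃∈ , z₂∈ , inj₂ (trans (+-comm z₃ z₂) z₂+z₃)

role : Fin 6 → Fin 3
role zero                                = zero
role (suc zero)                          = suc zero
role (suc (suc zero))                    = suc (suc zero)
role (suc (suc (suc zero)))              = suc (suc zero)
role (suc (suc (suc (suc zero))))        = suc zero
role (suc (suc (suc (suc (suc zero)))))  = zero

lowColumn : Fin 6 → Bool
lowColumn j = toℕ j <ᵇ 3

column : Fin 3 → Bool → Fin 6
column r true  = inject≤ r (s≤s (s≤s (s≤s z≤n)))
column r false = colFlip (inject≤ r (s≤s (s≤s (s≤s z≤n))))

column-role : ∀ j → column (role j) (lowColumn j) ≡ j
column-role zero                               = refl
column-role (suc zero)                         = refl
column-role (suc (suc zero))                   = refl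
column-role (suc (suc (suc zero)))             = refl
column-role (suc (suc (suc (suc zero))))       = refl
column-role (suc (suc (suc (suc (suc zero))))) = refl

columnOrder : ℕ → Fin 6 → Fin 6
columnOrder zero    j = j
columnOrder (suc _) j = colFlip j

columnOrder-involutive : ∀ p j → columnOrder p (columnOrder p j) ≡ j
columnOrder-involutive zero    j = refl
columnOrder-involutive (suc _) j = Fin.opposite-involutive j

columnOrder-injective : ∀ p {j j'} → columnOrder p j ≡ columnOrder p j' → j ≡ j'
columnOrder-injective p {j} {j'} eq =
  trans (sym (columnOrder-involutive p j)) (trans (cong (columnOrder p) eq) (columnOrder-involutive p j'))

UEdge : ℕ → ℕ → Graph
UEdge a b u v = (u ≡ a × v ≡ b) ⊎ (u ≡ b × v ≡ a)

module Labels (m : ℕ) where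

  mirror : ℕ → ℕ
  mirror z = 6 * m + 1 ∸ z

  sideLabel : Bool → ℕ → ℕ
  sideLabel b z = if b then z else mirror z

  evenRow : Triple → Fin 6 → ℕ
  evenRow T j = sideLabel (lowColumn j) (component T (role j))

  rowLabel : ℕ → Triple → Fin 6 → ℕ
  rowLabel p T j = evenRow T (columnOrder p j)

  +-mirror : ∀ {z} → z ≤ 6 * m + 1 → z + mirror z ≡ 6 * m + 1
  +-mirror = m+[n∸m]≡n

  mirror-+ : ∀ {z} → z ≤ 6 * m + 1 → mirror z + z ≡ 6 * m + 1
  mirror-+ = m∸n+n≡m

  mirror-involutive : ∀ {z} → z ≤ 6 * m + 1 → mirror (mirror z) ≡ z
  mirror-involutive = m∸[m∸n]≡n

  private
    3m+3m≡6m : 3 * m + 3 * m ≡ 6 * m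
    3m+3m≡6m = solve (m ∷ [])
    1+3m+3m≡N : suc (3 * m) + 3 * m ≡ 6 * m + 1
    1+3m+3m≡N = solve (m ∷ [])

  ≤3m⇒≤N : ∀ {z} → z ≤ 3 * m → z ≤ 6 * m + 1
  ≤3m⇒≤N z≤3m = ≤-trans z≤3m (m+n≡o⇒m≤o (suc (3 * m)) (trans (+-suc (3 * m) (3 * m)) 1+3m+3m≡N))

  3m<mirror : ∀ {z} → z ≤ 3 * m → 3 * m < mirror z
  3m<mirror {z} z≤3m = m+n≤o⇒m≤o∸n (suc (3 * m))
    (≤-trans (+-monoʳ-≤ (suc (3 * m)) z≤3m) (≤-reflexive 1+3m+3m≡N))

  ≤3m⇒≤mirror : ∀ {z} → z ≤ 3 * m → z ≤ mirror z
  ≤3m⇒≤mirror z≤3m = <⇒≤ (≤-<-trans z≤3m (3m<mirror z≤3m))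

  mirror-InV : ∀ {v} → 3 * m < v → v ≤ 6 * m → InV m (mirror v)
  mirror-InV {v} 3m<v v≤6m =
    m<n⇒0<n∸m (≤-trans (s≤s v≤6m) (≤-reflexive (+-comm 1 (6 * m)))) ,
    m≤n+o⇒m∸n≤o (6 * m + 1) v (≤-trans (≤-reflexive (sym 1+3m+3m≡N)) (+-monoˡ-≤ (3 * m) 3m<v))

  vert-sideLabel : ∀ b {z} → z ≤ 3 * m → vert m (sideLabel b z) ≡ z
  vert-sideLabel true  z≤3m = m≤n⇒m⊓n≡m (≤3m⇒≤mirror z≤3m)
  vert-sideLabel false {z} z≤3m = trans (cong (mirror z ⊓_) (mirror-involutive (≤3m⇒≤N z≤3m)))
                                    (m≥n⇒m⊓n≡n (≤3m⇒≤mirror z≤3m))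

  sideLabel-isLow : ∀ b {z} → z ≤ 3 * m → does (sideLabel b z ≤? 3 * m) ≡ b
  sideLabel-isLow true  {z} z≤3m = dec-true (z ≤? 3 * m) z≤3m
  sideLabel-isLow false {z} z≤3m = dec-false (mirror z ≤? 3 * m) (<⇒≱ (3m<mirror z≤3m))

  sideLabel-range : ∀ b {z} → InV m z → 1 ≤ sideLabel b z × sideLabel b z ≤ 6 * m
  sideLabel-range true  (1≤z , z≤3m) = 1≤z , ≤-trans z≤3m (m+n≡o⇒m≤o (3 * m) 3m+3m≡6m)
  sideLabel-range false {z} (1≤z , z≤3m) =
    ≤-trans (s≤s z≤n) (3m<mirror z≤3m) ,
    m≤n+o⇒m∸n≤o (6 * m + 1) z (≤-trans (≤-reflexive (+-comm (6 * m) 1)) (+-monoˡ-≤ (6 * m) 1≤z))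

  evenRow-column : ∀ T r b → evenRow T (column r b) ≡ sideLabel b (component T r)
  evenRow-column T zero             true  = refl
  evenRow-column T (suc zero)       true  = refl
  evenRow-column T (suc (suc zero)) true  = refl
  evenRow-column T zero             false = refl
  evenRow-column T (suc zero)       false = refl
  evenRow-column T (suc (suc zero)) false = refl

  vert-evenRow : ∀ {T} → InRange m T → ∀ j → vert m (evenRow T j) ≡ component T (role j)
  vert-evenRow inRange j = vert-sideLabel (lowColumn j) (proj₂ (inRange (role j)))

  evenRow-injective : ∀ {T} → InRange m T → ComponentsDistinct T → ∀ {j j'} → evenRow T j ≡ evenRow T j' → j ≡ j'
  evenRow-injective {T} inRange distinct {j} {j'} eq = begin
    j                           ≡⟨ column-role j ⟨
    column (role j) (lowColumn j)     ≡⟨ cong₂ column same-role same-side ⟩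
    column (role j') (lowColumn j')   ≡⟨ column-role j' ⟩
    j'                          ∎
    where
    open ≡-Reasoning
    same-role : role j ≡ role j'
    same-role = distinct (trans (sym (vert-evenRow inRange j)) (trans (cong (vert m) eq) (vert-evenRow inRange j')))
    same-side : lowColumn j ≡ lowColumn j'
    same-side = trans (sym (sideLabel-isLow (lowColumn j) (proj₂ (inRange (role j)))))
      (trans (cong (λ z → does (z ≤? 3 * m)) eq) (sideLabel-isLow (lowColumn j') (proj₂ (inRange (role j')))))

  rowLabel-injective : ∀ p {T} → InRange m T → ComponentsDistinct T → ∀ {j j'} → rowLabel p T j ≡ rowLabel p T j' → j ≡ j'
  rowLabel-injective p inRange distinct = columnOrder-injective p ∘ evenRow-injective inRange distinct

  private
    interchange : ∀ a b c d → a + b + c + d ≡ (a + c) + (b + d)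
    interchange = solve-∀

    pairs-sum : ∀ a b c d → a + b ≡ 6 * m + 1 → c + d ≡ 6 * m + 1 → a + b + c + d ≡ (6 * m + 1) + (6 * m + 1)
    pairs-sum a b c d ab cd = trans (+-assoc (a + b) c d) (cong₂ _+_ ab cd)

    pairs+mirrors : ∀ x y x' y' → x + y ≡ x' + y' → x' ≤ 6 * m + 1 → y' ≤ 6 * m + 1 →
      x + y + mirror x' + mirror y' ≡ (6 * m + 1) + (6 * m + 1)
    pairs+mirrors x y x' y' eq x'≤N y'≤N = begin
      x + y + mirror x' + mirror y'           ≡⟨ cong (λ s → s + mirror x' + mirror y') eq ⟩
      x' + y' + mirror x' + mirror y'         ≡⟨ interchange x' y' (mirror x') (mirror y') ⟩
      (x' + mirror x') + (y' + mirror y')     ≡⟨ cong₂ _+_ (+-mirror x'≤N) (+-mirror y'≤N) ⟩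
      (6 * m + 1) + (6 * m + 1)               ∎
      where open ≡-Reasoning

    mirrors+pairs : ∀ x y x' y' → x + y ≡ x' + y' → x ≤ 6 * m + 1 → y ≤ 6 * m + 1 →
      mirror x + mirror y + x' + y' ≡ (6 * m + 1) + (6 * m + 1)
    mirrors+pairs x y x' y' eq x≤N y≤N = begin
      mirror x + mirror y + x' + y'           ≡⟨ +-assoc (mirror x + mirror y) x' y' ⟩
      mirror x + mirror y + (x' + y')         ≡⟨ cong (mirror x + mirror y +_) eq ⟨
      mirror x + mirror y + (x + y)           ≡⟨ +-assoc (mirror x + mirror y) x y ⟨
      mirror x + mirror y + x + y             ≡⟨ interchange (mirror x) (mirror y) x y ⟩
      (mirror x + x) + (mirror y + y)         ≡⟨ cong₂ _+_ (mirror-+ x≤N) (mirror-+ y≤N) ⟩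
      (6 * m + 1) + (6 * m + 1)               ∎
      where open ≡-Reasoning

  module _ {a₁ a₂ : ℕ} {T T' : Triple} (isChain : IsChain m a₁ a₂ T) (isChain' : IsChain m a₁ a₂ T') where
    private
      module C  = IsChain isChain
      module C' = IsChain isChain'
      a b c a' b' c' : ℕ
      a  = first T
      b  = second T
      c  = third T
      a' = first T'
      b' = second T'
      c' = third T'

      a≤N : a ≤ 6 * m + 1
      a≤N = ≤3m⇒≤N (proj₂ (C.inRange zero))
      b≤N : b ≤ 6 * m + 1
      b≤N = ≤3m⇒≤N (proj₂ (C.inRange (suc zero)))
      c≤N : c ≤ 6 * m + 1
      c≤N = ≤3m⇒≤N (proj₂ (C.inRange (suc (suc zero))))
      a'≤N : a' ≤ 6 * m + 1
      a'≤N = ≤3m⇒≤N (proj₂ (C'.inRange zero))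
      b'≤N : b' ≤ 6 * m + 1
      b'≤N = ≤3m⇒≤N (proj₂ (C'.inRange (suc zero)))
      c'≤N : c' ≤ 6 * m + 1
      c'≤N = ≤3m⇒≤N (proj₂ (C'.inRange (suc (suc zero))))

      ab : a + b ≡ a' + b'
      ab = trans C.first+second (sym C'.first+second)
      bc : b + c ≡ b' + c'
      bc = trans C.second+third (sym C'.second+third)
      ba : b + a ≡ b' + a'
      ba = trans (+-comm b a) (trans ab (+-comm a' b'))
      cb : c + b ≡ c' + b'
      cb = trans (+-comm c b) (trans bc (+-comm b' c'))

    even-over-odd-face : ∀ j →
      rowLabel 0 T j + rowLabel 0 T (colSuc j) + rowLabel 1 T' j + rowLabel 1 T' (colSuc j) ≡ (6 * m + 1) + (6 * m + 1)
    even-over-odd-face zero                               = pairs+mirrors a b a' b' ab a'≤N b'≤N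
    even-over-odd-face (suc zero)                         = pairs+mirrors b c b' c' bc b'≤N c'≤N
    even-over-odd-face (suc (suc zero))                   = pairs-sum c (mirror c) (mirror c') c' (+-mirror c≤N) (mirror-+ c'≤N)
    even-over-odd-face (suc (suc (suc zero)))             = mirrors+pairs c b c' b' cb c≤N b≤N
    even-over-odd-face (suc (suc (suc (suc zero))))       = mirrors+pairs b a b' a' ba b≤N a≤N
    even-over-odd-face (suc (suc (suc (suc (suc zero))))) = pairs-sum (mirror a) a a' (mirror a') (mirror-+ a≤N) (+-mirror a'≤N)

    odd-over-even-face : ∀ j →
      rowLabel 1 T j + rowLabel 1 T (colSuc j) + rowLabel 0 T' j + rowLabel 0 T' (colSuc j) ≡ (6 * m + 1) + (6 * m + 1)
    odd-over-even-face zero                               = mirrors+pairs a b a' b' ab a≤N b≤N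
    odd-over-even-face (suc zero)                         = mirrors+pairs b c b' c' bc b≤N c≤N
    odd-over-even-face (suc (suc zero))                   = pairs-sum (mirror c) c c' (mirror c') (mirror-+ c≤N) (+-mirror c'≤N)
    odd-over-even-face (suc (suc (suc zero)))             = pairs+mirrors c b c' b' cb c'≤N b'≤N
    odd-over-even-face (suc (suc (suc (suc zero))))       = pairs+mirrors b a b' a' ba b'≤N a'≤N
    odd-over-even-face (suc (suc (suc (suc (suc zero))))) = pairs-sum a (mirror a) (mirror a') a' (+-mirror a≤N) (mirror-+ a'≤N)

    face : ∀ p p' → (p ≡ 0 × p' ≡ 1) ⊎ (p ≡ 1 × p' ≡ 0) → ∀ j →
      rowLabel p T j + rowLabel p T (colSuc j) + rowLabel p' T' j + rowLabel p' T' (colSuc j) ≡ (6 * m + 1) + (6 * m + 1)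
    face _ _ (inj₁ (refl , refl)) = even-over-odd-face
    face _ _ (inj₂ (refl , refl)) = odd-over-even-face

  RowLinks : ℕ → (Fin 6 → ℕ) → Graph
  RowLinks p x u v =
      (p ≡ 0 × (Link m (x c0) (x c1) u v ⊎ Link m (x c1) (x c2) u v))
    ⊎ (p ≡ 1 × (Link m (x c5) (x c4) u v ⊎ Link m (x c4) (x c3) u v))

  module _ {T : Triple} {u v : ℕ} (inRange : InRange m T) where
    private
      fixed : ∀ r → vert m (component T r) ≡ component T r
      fixed r = vert-sideLabel true (proj₂ (inRange r))

      ChainLinks : Set
      ChainLinks = Link m (first T) (second T) u v ⊎ Link m (second T) (third T) u v

      chainLinks⇒pathEdge : ChainLinks → PathEdge u v T
      chainLinks⇒pathEdge = assocʳ ∘ Sum.map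
        (subst₂ (λ a b → UEdge a b u v) (fixed zero) (fixed (suc zero)))
        (subst₂ (λ a b → UEdge a b u v) (fixed (suc zero)) (fixed (suc (suc zero))))

      pathEdge⇒chainLinks : PathEdge u v T → ChainLinks
      pathEdge⇒chainLinks = Sum.map
        (subst₂ (λ a b → UEdge a b u v) (sym (fixed zero)) (sym (fixed (suc zero))))
        (subst₂ (λ a b → UEdge a b u v) (sym (fixed (suc zero))) (sym (fixed (suc (suc zero))))) ∘ assocˡ

    rowLinks⇒pathEdge : ∀ p → RowLinks p (rowLabel p T) u v → PathEdge u v T
    rowLinks⇒pathEdge _ (inj₁ (refl , links)) = chainLinks⇒pathEdge links
    rowLinks⇒pathEdge _ (inj₂ (refl , links)) = chainLinks⇒pathEdge links

    pathEdge⇒rowLinks : ∀ p → p ≡ 0 ⊎ p ≡ 1 → PathEdge u v T → RowLinks p (rowLabel p T) u v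
    pathEdge⇒rowLinks _ (inj₁ refl) edge = inj₁ (refl , pathEdge⇒chainLinks edge)
    pathEdge⇒rowLinks _ (inj₂ refl) edge = inj₂ (refl , pathEdge⇒chainLinks edge)

%2-suc : ∀ n → (n % 2 ≡ 0 × suc n % 2 ≡ 1) ⊎ (n % 2 ≡ 1 × suc n % 2 ≡ 0)
%2-suc zero          = inj₁ (refl , refl)
%2-suc (suc zero)    = inj₂ (refl , refl)
%2-suc (suc (suc n)) = %2-suc n

%2≡0⊎%2≡1 : ∀ n → n % 2 ≡ 0 ⊎ n % 2 ≡ 1
%2≡0⊎%2≡1 n = Sum.map proj₁ proj₁ (%2-suc n)

module Construction (m' K' L : ℕ) (K'+L≡m : K' + L ≡ suc m') (m'-even : m' % 2 ≡ 0) where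

  m a₁ a₂ : ℕ
  m  = suc m'
  a₁ = 2 * m + suc K'
  a₂ = 3 * m + suc K'

  open Labels m

  chains : ℕ → Triple
  chains = chain K' L

  chains-isChain : ∀ {e} → e < m → IsChain m a₁ a₂ (chains e)
  chains-isChain {e} e<m = subst (λ n → IsChain n (2 * n + suc K') (3 * n + suc K') (chains e)) K'+L≡m
    (chain-isChain K' L (subst (e <_) (sym K'+L≡m) e<m))

  chains-cover : concatMap tripleVerts (map chains (upTo m)) ↭ map suc (upTo (3 * m))
  chains-cover = subst (λ n → concatMap tripleVerts (map chains (upTo n)) ↭ map suc (upTo (3 * n))) K'+L≡m
    (chain-cover K' L)

  cell : ℕ × Fin 3 → ℕ
  cell = uncurry (component ∘ chains)

  cells : List (ℕ × Fin 3)
  cells = cartesianProduct (upTo m) (allFin 3)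

  cell-labels-cover : map cell cells ↭ map suc (upTo (3 * m))
  cell-labels-cover = subst (_↭ map suc (upTo (3 * m))) (concatMap-tripleVerts chains (upTo m)) chains-cover

  cell-labels-unique : Unique (map cell cells)
  cell-labels-unique = Unique-resp-↭ (↭-sym cell-labels-cover) (Unique.map⁺ suc-injective (Unique.upTo⁺ (3 * m)))

  cell-injective : ∀ {e e' r r'} → e < m → e' < m → component (chains e) r ≡ component (chains e') r' →
    e ≡ e' × r ≡ r'
  cell-injective {r = r} {r'} e<m e'<m = ,-injective ∘
    map-injectiveOn cell cell-labels-unique (∈-cartesianProduct⁺ (∈-upTo⁺ e<m) (∈-allFin r))
                                             (∈-cartesianProduct⁺ (∈-upTo⁺ e'<m) (∈-allFin r'))

  cell-surjective : ∀ {v} → InV m v → ∃[ e ] ∃[ r ] e < m × component (chains e) r ≡ v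
  cell-surjective {suc w} (_ , v≤3m)
    with (e , r) , er∈cells , v≡cell ← ∈-map⁻ cell (∈-resp-↭ (↭-sym cell-labels-cover) (∈-map⁺ suc (∈-upTo⁺ v≤3m)))
    = e , r , ∈-upTo⁻ (proj₁ (∈-cartesianProduct⁻ (upTo m) (allFin 3) er∈cells)) , sym v≡cell

  chains-distinct : ∀ {e} → e < m → ComponentsDistinct (chains e)
  chains-distinct e<m = proj₂ ∘ cell-injective e<m e<m

  K : Graph
  K u v = Any (PathEdge u v) (map chains (upTo m))

  K-partition : IsAdmPathPartition m a₁ a₂ K
  K-partition = K-in-G , map chains (upTo m) , trans (length-map chains (upTo m)) (length-upTo m) ,
    Allₚ.map⁺ (Allₚ.applyUpTo⁺₁ id m admissible) , chains-cover , λ u v → id , id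
    where
    admissible : ∀ {e} → e < m → AdmPath m a₁ a₂ (chains e)
    admissible e<m = isChain⇒admPath (chains-isChain e<m) (chains-distinct e<m)
    K-in-G : ∀ u v → K u v → GAdj m a₁ a₂ u v
    K-in-G u v k with T , T∈ , edge ← find k with e , e∈ , refl ← ∈-map⁻ chains T∈ =
      admPath-edge⇒GAdj {m} (admissible (∈-upTo⁻ e∈)) edge

  rowPerm : Fin (m' !) → Permutation m m
  rowPerm t = lift₀ (permutation m' t)

  rowIndex : Fin (m' !) → Fin m → ℕ
  rowIndex t i = toℕ (rowPerm t ⟨$⟩ʳ i)

  rowChain : Fin (m' !) → Fin m → Triple
  rowChain t i = chains (rowIndex t i)

  rowChain-isChain : ∀ t i → IsChain m a₁ a₂ (rowChain t i)
  rowChain-isChain t i = chains-isChain (Fin.toℕ<n _)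

  rowChain-inRange : ∀ t i → InRange m (rowChain t i)
  rowChain-inRange t i = IsChain.inRange (rowChain-isChain t i)

  X : Fin (m' !) → Labeling m
  X t i = rowLabel (toℕ i % 2) (rowChain t i)

  vert-X : ∀ t i j → vert m (X t i j) ≡ component (rowChain t i) (role (columnOrder (toℕ i % 2) j))
  vert-X t i j = vert-evenRow (rowChain-inRange t i) (columnOrder (toℕ i % 2) j)

  X-rowIndex : ∀ t i j t' i' j' → X t i j ≡ X t' i' j' → rowIndex t i ≡ rowIndex t' i'
  X-rowIndex t i j t' i' j' eq = proj₁ (cell-injective
    {r = role (columnOrder (toℕ i % 2) j)} {role (columnOrder (toℕ i' % 2) j')} (Fin.toℕ<n _) (Fin.toℕ<n _)
    (trans (sym (vert-X t i j)) (trans (cong (vert m) eq) (vert-X t' i' j'))))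

  X-injective : ∀ t i j i' j' → X t i j ≡ X t i' j' → i ≡ i' × j ≡ j'
  X-injective t i j i' j' eq =
    i≡i' , rowLabel-injective (toℕ i' % 2) (rowChain-inRange t i') (chains-distinct (Fin.toℕ<n _))
             (subst (λ k → X t k j ≡ X t i' j') i≡i' eq)
    where
    i≡i' : i ≡ i'
    i≡i' = ⟨$⟩ʳ-injective (rowPerm t) (Fin.toℕ-injective (X-rowIndex t i j t i' j' eq))

  rowOf : ∀ {e} → e < m → Fin (m' !) → Fin m
  rowOf e<m t = rowPerm t ⟨$⟩ˡ fromℕ< e<m

  rowChain-rowOf : ∀ {e} (e<m : e < m) t → rowChain t (rowOf e<m t) ≡ chains e
  rowChain-rowOf e<m t = cong chains (trans (cong toℕ (inverseʳ (rowPerm t))) (Fin.toℕ-fromℕ< e<m))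

  X-sideLabel : ∀ t {e} → e < m → ∀ r b → ∃[ i ] ∃[ j ] X t i j ≡ sideLabel b (component (chains e) r)
  X-sideLabel t {e} e<m r b = i , columnOrder (toℕ i % 2) (column r b) , (begin
    evenRow (rowChain t i) (columnOrder (toℕ i % 2) (columnOrder (toℕ i % 2) (column r b)))
      ≡⟨ cong (evenRow (rowChain t i)) (columnOrder-involutive (toℕ i % 2) (column r b)) ⟩
    evenRow (rowChain t i) (column r b)           ≡⟨ evenRow-column (rowChain t i) r b ⟩
    sideLabel b (component (rowChain t i) r)      ≡⟨ cong (λ T → sideLabel b (component T r)) (rowChain-rowOf e<m t) ⟩
    sideLabel b (component (chains e) r)          ∎)
    where
    open ≡-Reasoning
    i : Fin m
    i = rowOf e<m t

  X-surjective : ∀ t v → 1 ≤ v → v ≤ 6 * m → ∃[ i ] ∃[ j ] X t i j ≡ v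
  X-surjective t v 1≤v v≤6m with v ≤? 3 * m
  ... | yes v≤3m with e , r , e<m , cell≡v ← cell-surjective (1≤v , v≤3m)
                 with i , j , X≡cell ← X-sideLabel t e<m r true =
    i , j , trans X≡cell cell≡v
  ... | no  v≰3m with e , r , e<m , cell≡v ← cell-surjective (mirror-InV (≰⇒> v≰3m) v≤6m)
                 with i , j , X≡cell ← X-sideLabel t e<m r false =
    i , j , trans X≡cell (trans (cong mirror cell≡v) (mirror-involutive (≤-trans v≤6m (m≤m+n (6 * m) 1))))

  X-range : ∀ t i j → 1 ≤ X t i j × X t i j ≤ 6 * m
  X-range t i j =
    sideLabel-range (lowColumn (columnOrder (toℕ i % 2) j)) (rowChain-inRange t i (role (columnOrder (toℕ i % 2) j)))

  X-faces : ∀ t i j → faceSum (X t) i j ≡ (6 * m + 1) + (6 * m + 1)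
  X-faces t i j with nextRow i in next
  ... | just i' = face (rowChain-isChain t i) (rowChain-isChain t i') (toℕ i % 2) (toℕ i' % 2) parities j
    where
    parities : (toℕ i % 2 ≡ 0 × toℕ i' % 2 ≡ 1) ⊎ (toℕ i % 2 ≡ 1 × toℕ i' % 2 ≡ 0)
    parities rewrite toℕ-nextRow next = %2-suc (toℕ i)
  -- the last row is even and the flipped first row reads like an odd row
  ... | nothing = face (rowChain-isChain t i) (rowChain-isChain t zero) (toℕ i % 2) 1 (inj₁ (last-row-even , refl)) j
    where
    last-row-even : toℕ i % 2 ≡ 0
    last-row-even = trans (cong (_% 2) (suc-injective (nextRow-last next))) m'-even

  X-magic : ∀ t → IsC4FaceMagic m (X t)
  X-magic t = (X-range t , X-injective t , X-surjective t) , _ , X-faces t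

  X-LGraph : ∀ t → SameGraph (LGraph m (X t)) K
  X-LGraph t u v = to , from
    where
    to : LGraph m (X t) u v → K u v
    to (i , links) = lose (∈-map⁺ chains (∈-upTo⁺ (Fin.toℕ<n (rowPerm t ⟨$⟩ʳ i))))
                          (rowLinks⇒pathEdge (rowChain-inRange t i) (toℕ i % 2) links)
    from : K u v → LGraph m (X t) u v
    from k with T , T∈ , edge ← find k with e , e∈ , refl ← ∈-map⁻ chains T∈ =
      i , pathEdge⇒rowLinks (rowChain-inRange t i) (toℕ i % 2) (%2≡0⊎%2≡1 (toℕ i))
            (subst (PathEdge u v) (sym (rowChain-rowOf e<m t)) edge)
      where
      e<m : e < m
      e<m = ∈-upTo⁻ e∈
      i : Fin m
      i = rowOf e<m t

  X-nonequivalent : ∀ t t' → t ≢ t' → ¬ KBEquiv (X t) (X t')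
  X-nonequivalent t t' t≢t' (w , X'≡X∘w) =
    t≢t' (permutation-injective m' λ i → sym (Fin.suc-injective (same-row (suc i))))
    where
    moved : Fin m → Fin m
    moved i = proj₁ (wordAct w (i , zero))
    index-agrees : ∀ i → rowIndex t' i ≡ rowIndex t (moved i)
    index-agrees i = X-rowIndex t' i zero t (moved i) (proj₂ (wordAct w (i , zero))) (X'≡X∘w i zero)
    row₀-fixed : moved zero ≡ zero
    row₀-fixed = ⟨$⟩ʳ-injective (rowPerm t) (Fin.toℕ-injective (sym (index-agrees zero)))
    same-row : ∀ i → rowPerm t' ⟨$⟩ʳ i ≡ rowPerm t ⟨$⟩ʳ i
    same-row i = Fin.toℕ-injective
      (trans (index-agrees i) (cong (rowIndex t) (wordAct-preserves-rows w row₀-fixed (i , zero))))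

pred-even : ∀ {n} → suc n % 2 ≡ 1 → n % 2 ≡ 0
pred-even {n} odd with %2-suc n
... | inj₁ (even , _)   = even
... | inj₂ (_ , suc-even) with () ← trans (sym suc-even) odd

proposition6p3 : (m k : ℕ) → m % 2 ≡ 1 → 3 ≤ m → 1 ≤ k → k ≤ m + 1 →
    Σ Graph λ K →
      IsAdmPathPartition m (2 * m + k) (3 * m + k) K
      × Σ (Fin ((m ∸ 1) !) → Labeling m) λ X →
          (∀ t → IsC4FaceMagic m (X t) × SameGraph (LGraph m (X t)) K)
          × (∀ t t' → t ≢ t' → ¬ KBEquiv (X t) (X t'))
proposition6p3 (suc m') (suc K') m-odd _ _ k≤m+1 =
  K , K-partition , X , (λ t → X-magic t , X-LGraph t) , X-nonequivalent
  where
  K'≤m : K' ≤ suc m'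
  K'≤m = s≤s⁻¹ (subst (suc K' ≤_) (+-comm (suc m') 1) k≤m+1)
  open Construction m' K' (suc m' ∸ K') (m+[n∸m]≡n K'≤m) (pred-even {m'} m-odd)
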